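{- Let $G$ be a finite triangle-free graph. The following are equivalent: (1) $\overline{L(G)}$ is a general partition graph; (2) every $2$-matching of $G$ extends to a perfect internal matching of $G$; (3) every connected component of $G$ is either a star or $2$-internally extendable.
   Context: $L(G)$ is the line graph of $G$ and $\overline{H}$ denotes the complement of a graph $H$. A graph $H=(V,E)$ is a general partition graph if there exist a set $U$ and an assignment of nonempty subsets $U_x\subseteq U$ to the vertices $x\in V$ such that $x,y$ are adjacent iff $U_x\cap U_y\ne\emptyset$, and for every maximal stable set $S$ of $H$, $\{U_x: x\in S\}$ is a partition of $U$. A star is a graph isomorphic to $K_{1,n}$, $n\ge1$. A $k$-matching is a matching with exactly $k$ edges; $M$ extends to $M'$ if $M\subseteq M'$. A matching $M$ is a perfect internal matching if every vertex not covered by $M$ has degree $1$. For $k\ge1$, a connected graph is $k$-internally extendable if it contains a $k$-matching and every $k$-matching extends to a perfect internal matching. -}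

module Defs where

open import Data.Nat using (ℕ)
open import Data.Fin using (Fin; _<_)
open import Data.Bool using (Bool; true; false)
open import Data.Product using (Σ; ∃; _×_; _,_)
open import Data.Sum using (_⊎_)
open import Data.Unit using (⊤)
open import Data.Empty using (⊥)
open import Level using (Level; suc; _⊔_) renaming (zero to lzero)
open import Relation.Nullary using (¬_)
open import Relation.Binary.PropositionalEquality using (_≡_; _≢_)

record Graph : Set where
  field
    n      : ℕ
    adj    : Fin n → Fin n → Bool
    sym    : ∀ u v → adj u v ≡ adj v u
    irrefl : ∀ u → adj u u ≡ false

module _ (G : Graph) where
  open Graph G

  Vertex : Set
  Vertex = Fin n

  Adj : Vertex → Vertex → Set
  Adj u v = adj u v ≡ true

  -- an edge {a,b} of G, stored once with a < b
  record Edge : Set where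
    constructor edge
    field
      a     : Vertex
      b     : Vertex
      a<b   : a < b
      isAdj : Adj a b

  Incident : Vertex → Edge → Set
  Incident x e = x ≡ Edge.a e ⊎ x ≡ Edge.b e

  ShareEndpoint : Edge → Edge → Set
  ShareEndpoint e f = ∃ λ x → Incident x e × Incident x f

  TriangleFree : Set
  TriangleFree = ∀ x y z → Adj x y → Adj y z → Adj x z → ⊥

  LineAdj : Edge → Edge → Set
  LineAdj e f = e ≢ f × ShareEndpoint e f

  -- Notions relative to the induced subgraph G[C] on a vertex set C.

  EdgeIn : (Vertex → Set) → Edge → Set
  EdgeIn C e = C (Edge.a e) × C (Edge.b e)

  IsMatching : (Vertex → Set) → (Edge → Bool) → Set
  IsMatching C M =
    (∀ e → M e ≡ true → EdgeIn C e) ×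
    (∀ e f → M e ≡ true → M f ≡ true → e ≢ f → ¬ ShareEndpoint e f)

  Covered : (Edge → Bool) → Vertex → Set
  Covered M v = ∃ λ e → M e ≡ true × Incident v e

  DegreeOne : (Vertex → Set) → Vertex → Set
  DegreeOne C v = ∃ λ w → C w × Adj v w × (∀ w' → C w' → Adj v w' → w' ≡ w)

  IsPerfectInternalMatching : (Vertex → Set) → (Edge → Bool) → Set
  IsPerfectInternalMatching C M =
    IsMatching C M × (∀ v → C v → ¬ Covered M v → DegreeOne C v)

  Is2Matching : (Vertex → Set) → Edge → Edge → Set
  Is2Matching C e f = EdgeIn C e × EdgeIn C f × e ≢ f × ¬ ShareEndpoint e f

  ExtendsToPIM : (Vertex → Set) → Edge → Edge → Set
  ExtendsToPIM C e f = ∃ λ M → M e ≡ true × M f ≡ true × IsPerfectInternalMatching C M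

  -- G[C] is 2-internally extendable (connectivity of G[C] is supplied separately)
  TwoInternallyExtendable : (Vertex → Set) → Set
  TwoInternallyExtendable C =
    (∃ λ e → ∃ λ f → Is2Matching C e f) ×
    (∀ e f → Is2Matching C e f → ExtendsToPIM C e f)

  IsStar : (Vertex → Set) → Set
  IsStar C = ∃ λ c → C c ×
    (∃ λ w → C w × w ≢ c) ×
    (∀ w → C w → w ≢ c → Adj c w) ×
    (∀ w w' → C w → C w' → Adj w w' → w ≡ c ⊎ w' ≡ c)

  -- reachability; the connected component of x is the set Reach x
  data Reach (x : Vertex) : Vertex → Set where
    here : Reach x x
    step : ∀ {v w} → Reach x v → Adj v w → Reach x w

  Everything : Vertex → Set
  Everything _ = ⊤

Complement : ∀ {V : Set} → (V → V → Set) → V → V → Set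
Complement R x y = x ≢ y × ¬ R x y

module _ {V : Set} (R : V → V → Set) where

  IsStable : (V → Bool) → Set
  IsStable S = ∀ x y → S x ≡ true → S y ≡ true → ¬ R x y

  IsMaximalStable : (V → Bool) → Set
  IsMaximalStable S = IsStable S ×
    (∀ T → IsStable T → (∀ x → S x ≡ true → T x ≡ true) → ∀ x → T x ≡ true → S x ≡ true)

  IsGeneralPartitionGraph : Set₁
  IsGeneralPartitionGraph =
    Σ Set λ U → Σ (V → U → Set) λ Ux →
      (∀ x → ∃ λ u → Ux x u) ×
      (∀ x y → x ≢ y → (R x y → ∃ λ u → Ux x u × Ux y u) × ((∃ λ u → Ux x u × Ux y u) → R x y)) ×
      (∀ S → IsMaximalStable S →
        (∀ u → ∃ λ x → S x ≡ true × Ux x u) ×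
        (∀ x y → S x ≡ true → S y ≡ true → x ≢ y → ∀ u → Ux x u → Ux y u → ⊥))

NoIsolatedVertices : Graph → Set
NoIsolatedVertices G = ∀ v → ∃ λ w → Adj G v w

module Submission where

-- Stable sets of H are intersecting families of edges, and in a triangle-free graph such a
-- family has a common vertex; so maximal stable sets of H lie in stars, and stars of branching
-- vertices are maximal.
--   (1) ⇒ (2): the two edges share a label, and every maximal star contains an edge with it.
--   (2) ⇒ (1): label each edge by the nonempty saturated PIMs (PIMs that are maximal matchings)
--     containing it; saturating a PIM yields one, and a maximal stable set, lying in a star,
--     meets each of them exactly once.
--   (2) ⇔ (3): PIMs restrict to components and glue along canonical representatives (least
--     vertices; reachability is decided by iterated exploration), and a component without a
--     2-matching has pairwise meeting edges, hence is a star.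

open import Defs
open import Data.Bool using (Bool; true; false; _∨_; _∧_)
open import Data.Bool.Properties using (∨-zeroʳ) renaming (_≟_ to _≟ᵇ_)
open import Data.Empty using (⊥; ⊥-elim)
open import Data.Fin using (Fin′; _<_; fromℕ<; inject)
open import Data.Fin.Properties
  using (_≟_; _<?_; <-cmp; <-asym; <-irrelevant; any?; ¬∀⟶∃¬; ¬∀⟶∃¬-smallest;
         toℕ-injective; toℕ-inject; toℕ-fromℕ<)
open import Data.Fin.Subset using (Subset; _∈_; _⊆_; _⊂_; ⁅_⁆; ∣_∣)
open import Data.Fin.Subset.Properties
  using (_∈?_; _⊆?_; x∈⁅x⁆; x∈⁅y⁆⇒x≡y; ∣⁅x⁆∣≡1; ∣p∣≤n; p⊂q⇒∣p∣<∣q∣)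
open import Data.Nat as ℕ using (ℕ; zero; suc; s≤s; z≤n)
import Data.Nat.Properties as ℕ
open import Data.Product using (Σ; ∃; _×_; _,_; proj₁; proj₂)
open import Data.Sum using (_⊎_; inj₁; inj₂)
open import Data.Unit using (tt)
open import Data.Vec using (tabulate)
open import Data.Vec.Properties using (lookup∘tabulate; []=⇒lookup; lookup⇒[]=)
open import Function using (_∘_)
open import Function.Bundles using (_⇔_; mk⇔)
open import Data.Maybe using (Maybe; just; nothing)
open import Data.Maybe.Properties using (≡-dec)
open import Relation.Binary using (tri<; tri≈; tri>)
open import Relation.Binary.PropositionalEquality
open import Relation.Nullary using (¬_; Dec; yes; no; does)
open import Relation.Nullary.Decidable
  using (_⊎-dec_; _×-dec_; ¬?; _→-dec_; map′; decidable-stable; dec-true)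
import Axiom.UniquenessOfIdentityProofs as UIP

does⇒ : ∀ {A : Set} (a? : Dec A) → does a? ≡ true → A
does⇒ (yes a) _ = a

module _ (G : Graph) where
  open Graph G using (n; adj) renaming (sym to adj-comm; irrefl to adj-irrefl)

  private
    V : Set
    V = Vertex G
    E : Set
    E = Edge G
    _~_ : V → V → Set
    _~_ = Adj G
    _∈ₑ_ : V → E → Set
    _∈ₑ_ = Incident G
    Meets : E → E → Set
    Meets = ShareEndpoint G
    IsPIM : (V → Set) → (E → Bool) → Set
    IsPIM = IsPerfectInternalMatching G

  ~-sym : ∀ {u v} → u ~ v → v ~ u
  ~-sym {u} {v} p = trans (adj-comm v u) p

  ~⇒≢ : ∀ {u v} → u ~ v → u ≢ v
  ~⇒≢ {u} p refl with trans (sym p) (adj-irrefl u)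
  ... | ()

  _~?_ : ∀ u v → Dec (u ~ v)
  u ~? v = adj u v ≟ᵇ true

  edge-ext : ∀ {e f : E} → Edge.a e ≡ Edge.a f → Edge.b e ≡ Edge.b f → e ≡ f
  edge-ext {edge a b a<b p} {edge _ _ a<b′ p′} refl refl =
    cong₂ (edge a b) (<-irrelevant a<b a<b′) (UIP.Decidable⇒UIP.≡-irrelevant _≟ᵇ_ p p′)

  _≟ₑ_ : (e f : E) → Dec (e ≡ f)
  e ≟ₑ f with Edge.a e ≟ Edge.a f | Edge.b e ≟ Edge.b f
  ... | yes p | yes q = yes (edge-ext p q)
  ... | no ¬p | _     = no (¬p ∘ cong Edge.a)
  ... | yes _ | no ¬q = no (¬q ∘ cong Edge.b)

  edgeOn : ∀ u v → u ~ v → E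
  edgeOn u v p with <-cmp u v
  ... | tri< u<v _ _ = edge u v u<v p
  ... | tri≈ _ u≡v _ = ⊥-elim (~⇒≢ p u≡v)
  ... | tri> _ _ v<u = edge v u v<u (~-sym p)

  edgeOn-ends : ∀ u v (p : u ~ v) → u ∈ₑ edgeOn u v p × v ∈ₑ edgeOn u v p
  edgeOn-ends u v p with <-cmp u v
  ... | tri< _ _ _   = inj₁ refl , inj₂ refl
  ... | tri≈ _ u≡v _ = ⊥-elim (~⇒≢ p u≡v)
  ... | tri> _ _ _   = inj₂ refl , inj₁ refl

  ends-of : ∀ {v w z e} → v ∈ₑ e → w ∈ₑ e → v ≢ w → z ∈ₑ e → z ≡ v ⊎ z ≡ w
  ends-of (inj₁ p) (inj₂ q) _ (inj₁ r) = inj₁ (trans r (sym p))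
  ends-of (inj₁ p) (inj₂ q) _ (inj₂ r) = inj₂ (trans r (sym q))
  ends-of (inj₂ p) (inj₁ q) _ (inj₁ r) = inj₂ (trans r (sym q))
  ends-of (inj₂ p) (inj₁ q) _ (inj₂ r) = inj₁ (trans r (sym p))
  ends-of (inj₁ p) (inj₁ q) v≢w _ = ⊥-elim (v≢w (trans p (sym q)))
  ends-of (inj₂ p) (inj₂ q) v≢w _ = ⊥-elim (v≢w (trans p (sym q)))

  edgeOn-only : ∀ {u v z} (p : u ~ v) → z ∈ₑ edgeOn u v p → z ≡ u ⊎ z ≡ v
  edgeOn-only {u} {v} p =
    let (u∈ , v∈) = edgeOn-ends u v p in ends-of {e = edgeOn u v p} u∈ v∈ (~⇒≢ p)

  ends-adj : ∀ {x y e} → x ∈ₑ e → y ∈ₑ e → x ≢ y → x ~ y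
  ends-adj {e = e} (inj₁ refl) (inj₂ refl) _ = Edge.isAdj e
  ends-adj {e = e} (inj₂ refl) (inj₁ refl) _ = ~-sym (Edge.isAdj e)
  ends-adj (inj₁ refl) (inj₁ refl) x≢y = ⊥-elim (x≢y refl)
  ends-adj (inj₂ refl) (inj₂ refl) x≢y = ⊥-elim (x≢y refl)

  partner : ∀ {x e} → x ∈ₑ e → ∃ λ y → y ∈ₑ e × x ~ y
  partner {e = e} (inj₁ refl) = Edge.b e , inj₂ refl , Edge.isAdj e
  partner {e = e} (inj₂ refl) = Edge.a e , inj₁ refl , ~-sym (Edge.isAdj e)

  edge-unique : ∀ {x y} e f → x ≢ y → x ∈ₑ e → y ∈ₑ e → x ∈ₑ f → y ∈ₑ f → e ≡ f
  edge-unique e f x≢y x∈e y∈e x∈f y∈f = same-ends (into (inj₁ refl)) (into (inj₂ refl))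
    where
    into : ∀ {z} → z ∈ₑ e → z ∈ₑ f
    into z∈e with ends-of {e = e} x∈e y∈e x≢y z∈e
    ... | inj₁ refl = x∈f
    ... | inj₂ refl = y∈f
    a≢b : Edge.a e ≢ Edge.b e
    a≢b = ~⇒≢ (Edge.isAdj e)
    same-ends : Edge.a e ∈ₑ f → Edge.b e ∈ₑ f → e ≡ f
    same-ends (inj₁ p) (inj₂ q) = edge-ext p q
    same-ends (inj₁ p) (inj₁ q) = ⊥-elim (a≢b (trans p (sym q)))
    same-ends (inj₂ p) (inj₂ q) = ⊥-elim (a≢b (trans p (sym q)))
    same-ends (inj₂ p) (inj₁ q) = ⊥-elim (<-asym (subst₂ _<_ p q (Edge.a<b e)) (Edge.a<b f))

  meets-refl : ∀ e → Meets e e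
  meets-refl e = Edge.a e , inj₁ refl , inj₁ refl

  disjoint⇒≢ : ∀ {e f} → ¬ Meets e f → e ≢ f
  disjoint⇒≢ {e} ¬m refl = ¬m (meets-refl e)

  meets-at-other : ∀ {v w g k} → v ∈ₑ k → w ∈ₑ k → v ≢ w → Meets g k → ¬ v ∈ₑ g → w ∈ₑ g
  meets-at-other {k = k} v∈k w∈k v≢w (z , z∈g , z∈k) v∉g with ends-of {e = k} v∈k w∈k v≢w z∈k
  ... | inj₁ refl = ⊥-elim (v∉g z∈g)
  ... | inj₂ refl = z∈g

  _∈ₑ?_ : ∀ x e → Dec (x ∈ₑ e)
  x ∈ₑ? e = (x ≟ Edge.a e) ⊎-dec (x ≟ Edge.b e)

  Meets? : ∀ e f → Dec (Meets e f)
  Meets? e f = any? (λ x → (x ∈ₑ? e) ×-dec (x ∈ₑ? f))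

  any-edge? : {P : E → Set} → (∀ e → Dec (P e)) → Dec (∃ P)
  any-edge? {P} P? = map′ (λ (a , b , a<b , p , r) → edge a b a<b p , r)
                          (λ (edge a b a<b p , r) → a , b , a<b , p , r)
                          (any? λ a → any? λ b → on-pair a b)
    where
    on-pair : ∀ a b → Dec (Σ (a < b) λ a<b → Σ (a ~ b) λ p → P (edge a b a<b p))
    on-pair a b with a <? b | a ~? b
    ... | no a≮b | _     = no (a≮b ∘ proj₁)
    ... | yes _  | no ¬p = no (¬p ∘ proj₁ ∘ proj₂)
    ... | yes a<b | yes p =
      map′ (λ r → a<b , p , r) (λ (_ , _ , r) → subst P (edge-ext refl refl) r) (P? (edge a b a<b p))

  Covered? : ∀ M v → Dec (Covered G M v)
  Covered? M v = any-edge? (λ e → (M e ≟ᵇ true) ×-dec (v ∈ₑ? e))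

  Closed : (V → Set) → Set
  Closed C = ∀ {v w} → C v → v ~ w → C w

  closed-edge : ∀ {C z g} → Closed C → C z → z ∈ₑ g → EdgeIn G C g
  closed-edge {g = g} closed Cz (inj₁ refl) = Cz , closed Cz (Edge.isAdj g)
  closed-edge {g = g} closed Cz (inj₂ refl) = closed Cz (~-sym (Edge.isAdj g)) , Cz

  EdgeIn? : ∀ {C} → (∀ v → Dec (C v)) → ∀ g → Dec (EdgeIn G C g)
  EdgeIn? C? g = C? (Edge.a g) ×-dec C? (Edge.b g)

  degree-one-within : ∀ {C v} → Closed C → C v → DegreeOne G (Everything G) v → DegreeOne G C v
  degree-one-within closed Cv (w , _ , v~w , unique) = w , closed Cv v~w , v~w , λ w′ _ → unique w′ tt

  degree-one-without : ∀ {C v} → Closed C → C v → DegreeOne G C v → DegreeOne G (Everything G) v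
  degree-one-without closed Cv (w , _ , v~w , unique) =
    w , tt , v~w , λ w′ _ v~w′ → unique w′ (closed Cv v~w′) v~w′

  Reach-closed : ∀ {x} → Closed (Reach G x)
  Reach-closed = step

  Reach-trans : ∀ {x y z} → Reach G x y → Reach G y z → Reach G x z
  Reach-trans r here = r
  Reach-trans r (step r′ p) = step (Reach-trans r r′) p

  Reach-sym : ∀ {x y} → Reach G x y → Reach G y x
  Reach-sym here = here
  Reach-sym (step r p) = Reach-trans (step here (~-sym p)) (Reach-sym r)

  Reach-along : ∀ {z g} → z ∈ₑ g → Reach G (Edge.a g) z
  Reach-along (inj₁ refl) = here
  Reach-along {g = g} (inj₂ refl) = step here (Edge.isAdj g)

  -- One round of exploration adds all neighbours to a vertex set;
  -- starting from {x}, the k-th ball either is closed or has more than k elements, so the n-th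
  -- ball is closed and therefore equals the component of x.
  Explored : Subset n → V → Set
  Explored p y = y ∈ p ⊎ (∃ λ v → v ∈ p × v ~ y)

  Explored? : ∀ p y → Dec (Explored p y)
  Explored? p y = (y ∈? p) ⊎-dec any? λ v → (v ∈? p) ×-dec (v ~? y)

  expand : Subset n → Subset n
  expand p = tabulate λ y → does (Explored? p y)

  ∈-expand⁺ : ∀ {p y} → Explored p y → y ∈ expand p
  ∈-expand⁺ {p} {y} h = lookup⇒[]= y (expand p) (trans (lookup∘tabulate _ y) (dec-true (Explored? p y) h))

  ∈-expand⁻ : ∀ {p y} → y ∈ expand p → Explored p y
  ∈-expand⁻ {p} {y} y∈ = does⇒ (Explored? p y) (trans (sym (lookup∘tabulate _ y)) ([]=⇒lookup y∈))

  ⊆-expand : ∀ {p} → p ⊆ expand p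
  ⊆-expand y∈p = ∈-expand⁺ (inj₁ y∈p)

  expand-mono : ∀ {p q} → p ⊆ q → expand p ⊆ expand q
  expand-mono p⊆q y∈ with ∈-expand⁻ y∈
  ... | inj₁ y∈p = ∈-expand⁺ (inj₁ (p⊆q y∈p))
  ... | inj₂ (v , v∈p , v~y) = ∈-expand⁺ (inj₂ (v , p⊆q v∈p , v~y))

  ball : V → ℕ → Subset n
  ball x zero = ⁅ x ⁆
  ball x (suc k) = expand (ball x k)

  ball-centre : ∀ x k → x ∈ ball x k
  ball-centre x zero = x∈⁅x⁆ x
  ball-centre x (suc k) = ⊆-expand (ball-centre x k)

  ball-sound : ∀ {x y} k → y ∈ ball x k → Reach G x y
  ball-sound {x} zero y∈ rewrite x∈⁅y⁆⇒x≡y x y∈ = here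
  ball-sound (suc k) y∈ with ∈-expand⁻ y∈
  ... | inj₁ y∈ball = ball-sound k y∈ball
  ... | inj₂ (v , v∈ball , v~y) = step (ball-sound k v∈ball) v~y

  expand-⊂ : ∀ {p} → ¬ expand p ⊆ p → p ⊂ expand p
  expand-⊂ {p} ¬closed with ¬∀⟶∃¬ n _ (λ y → (y ∈? expand p) →-dec (y ∈? p)) (λ all → ¬closed (all _))
  ... | y , ¬y∈⇒ =
    ⊆-expand , y , decidable-stable (y ∈? expand p) (λ y∉ → ¬y∈⇒ (⊥-elim ∘ y∉)) , (λ y∈p → ¬y∈⇒ (λ _ → y∈p))

  ball-grows : ∀ x k → expand (ball x k) ⊆ ball x k ⊎ k ℕ.< ∣ ball x k ∣
  ball-grows x zero = inj₂ (subst (0 ℕ.<_) (sym (∣⁅x⁆∣≡1 x)) (s≤s z≤n))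
  ball-grows x (suc k) with expand (ball x k) ⊆? ball x k | ball-grows x k
  ... | yes closed | _        = inj₁ (expand-mono closed)
  ... | no ¬closed | inj₁ closed = ⊥-elim (¬closed closed)
  ... | no ¬closed | inj₂ k<∣ball∣ =
    inj₂ (ℕ.≤-trans (s≤s k<∣ball∣) (p⊂q⇒∣p∣<∣q∣ (expand-⊂ ¬closed)))

  ball-closed : ∀ x → expand (ball x n) ⊆ ball x n
  ball-closed x with ball-grows x n
  ... | inj₁ closed = closed
  ... | inj₂ n<∣ball∣ = ⊥-elim (ℕ.<-irrefl refl (ℕ.<-≤-trans n<∣ball∣ (∣p∣≤n (ball x n))))

  ball-complete : ∀ {x y} → Reach G x y → y ∈ ball x n
  ball-complete {x} here = ball-centre x n
  ball-complete {x} (step r v~w) = ball-closed x (∈-expand⁺ (inj₂ (_ , ball-complete r , v~w)))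

  Reach? : ∀ x y → Dec (Reach G x y)
  Reach? x y = map′ (ball-sound n) ball-complete (y ∈? ball x n)

  -- The least vertex of a component is its canonical representative.
  private
    least : ∀ v → ∃ λ r → ¬ ¬ Reach G v r × ((j : Fin′ r) → ¬ Reach G v (inject j))
    least v = ¬∀⟶∃¬-smallest n (λ r → ¬ Reach G v r) (λ r → ¬? (Reach? v r)) (λ none → none v here)

  rep : V → V
  rep v = proj₁ (least v)

  rep-reach : ∀ v → Reach G v (rep v)
  rep-reach v = decidable-stable (Reach? v (rep v)) (proj₁ (proj₂ (least v)))

  rep-least : ∀ {v u} → Reach G v u → ¬ u < rep v
  rep-least {v} {u} r u<rep = proj₂ (proj₂ (least v)) (fromℕ< u<rep) (subst (Reach G v) (sym inject≡u) r)
    where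
    inject≡u : inject (fromℕ< u<rep) ≡ u
    inject≡u = toℕ-injective (trans (toℕ-inject (fromℕ< u<rep)) (toℕ-fromℕ< u<rep))

  rep-cong : ∀ {v v′} → Reach G v v′ → rep v ≡ rep v′
  rep-cong {v} {v′} r with <-cmp (rep v) (rep v′)
  ... | tri< lt _ _ = ⊥-elim (rep-least (Reach-trans (Reach-sym r) (rep-reach v)) lt)
  ... | tri≈ _ eq _ = eq
  ... | tri> _ _ gt = ⊥-elim (rep-least (Reach-trans r (rep-reach v′)) gt)

  private
    H : E → E → Set
    H = Complement (LineAdj G)

  H⇒disjoint : ∀ {e f} → H e f → ¬ Meets e f
  H⇒disjoint (e≢f , ¬line) m = ¬line (e≢f , m)

  disjoint⇒H : ∀ {e f} → ¬ Meets e f → H e f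
  disjoint⇒H ¬m = disjoint⇒≢ ¬m , ¬m ∘ proj₂

  stable-meets : ∀ {T x y} → IsStable H T → T x ≡ true → T y ≡ true → x ≢ y → Meets x y
  stable-meets {T} {x} {y} T-stable Tx Ty x≢y =
    decidable-stable (Meets? x y) (λ ¬m → T-stable x y Tx Ty (x≢y , ¬m ∘ proj₂))

  only : E → E → Bool
  only h g = does (g ≟ₑ h)

  only-self : ∀ h → only h h ≡ true
  only-self h = dec-true (h ≟ₑ h) refl

  only-unique : ∀ {h g} → only h g ≡ true → g ≡ h
  only-unique {h} {g} = does⇒ (g ≟ₑ h)

  only-stable : ∀ h → IsStable H (only h)
  only-stable h x y x∈ y∈ (x≢y , _) = x≢y (trans (only-unique x∈) (sym (only-unique y∈)))

  star : V → E → Bool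
  star v e = does (v ∈ₑ? e)

  star-stable : ∀ v → IsStable H (star v)
  star-stable v x y x∈ y∈ h = H⇒disjoint h (v , does⇒ (v ∈ₑ? x) x∈ , does⇒ (v ∈ₑ? y) y∈)

  star-⊆-maximal : ∀ {S v} → IsMaximalStable H S → (∀ y → S y ≡ true → v ∈ₑ y) →
                   ∀ y → v ∈ₑ y → S y ≡ true
  star-⊆-maximal {S} {v} (_ , S-max) S⊆star y v∈y =
    S-max (star v) (star-stable v) (λ x Sx → dec-true (v ∈ₑ? x) (S⊆star x Sx)) y (dec-true (v ∈ₑ? y) v∈y)

  stable-avoiding : ∀ {T x v w} → IsStable H T → T x ≡ true → ¬ v ∈ₑ x →
                    (p : v ~ w) → T (edgeOn v w p) ≡ true → w ∈ₑ x
  stable-avoiding {T} {x} {v} {w} T-stable Tx v∉x p Tvw =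
    meets-at-other {g = x} {k = edgeOn v w p} v∈ w∈ (~⇒≢ p) (stable-meets T-stable Tx Tvw x≢vw) v∉x
    where
    v∈ : v ∈ₑ edgeOn v w p
    v∈ = proj₁ (edgeOn-ends v w p)
    w∈ : w ∈ₑ edgeOn v w p
    w∈ = proj₂ (edgeOn-ends v w p)
    x≢vw : x ≢ edgeOn v w p
    x≢vw x≡vw = v∉x (subst (v ∈ₑ_) (sym x≡vw) v∈)

  Branching : V → Set
  Branching v = ∃ λ w₁ → ∃ λ w₂ → v ~ w₁ × v ~ w₂ × w₁ ≢ w₂

  Branching? : ∀ v → Dec (Branching v)
  Branching? v = any? λ w₁ → any? λ w₂ → (v ~? w₁) ×-dec (v ~? w₂) ×-dec ¬? (w₁ ≟ w₂)

  unbranched⇒degree-one : NoIsolatedVertices G → ∀ {v} → ¬ Branching v → DegreeOne G (Everything G) v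
  unbranched⇒degree-one no-isolated {v} ¬branching with no-isolated v
  ... | w , v~w = w , tt , v~w , λ w′ _ v~w′ →
        decidable-stable (w′ ≟ w) (λ w′≢w → ¬branching (w′ , w , v~w′ , v~w , w′≢w))

  leaf-edge : ∀ {v w y} → (∀ w′ → v ~ w′ → w′ ≡ w) → v ∈ₑ y → w ∈ₑ y
  leaf-edge {y = y} unique v∈y with partner {e = y} v∈y
  ... | z , z∈y , v~z = subst (_∈ₑ y) (unique z v~z) z∈y

  Exposed : (E → Bool) → E → Set
  Exposed M e = ¬ Covered G M (Edge.a e) × ¬ Covered G M (Edge.b e)

  Exposed? : ∀ M e → Dec (Exposed M e)
  Exposed? M e = ¬? (Covered? M (Edge.a e)) ×-dec ¬? (Covered? M (Edge.b e))

  exposed-end : ∀ {M e z} → Exposed M e → z ∈ₑ e → ¬ Covered G M z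
  exposed-end (a-exposed , _) (inj₁ refl) = a-exposed
  exposed-end (_ , b-exposed) (inj₂ refl) = b-exposed

  Saturated : (E → Bool) → Set
  Saturated M = ∀ e → Exposed M e → M e ≡ true

  saturate : (E → Bool) → E → Bool
  saturate M e = M e ∨ does (Exposed? M e)

  saturate-⊇ : ∀ {M e} → M e ≡ true → saturate M e ≡ true
  saturate-⊇ e∈M rewrite e∈M = refl

  saturate-exposed : ∀ {M e} → Exposed M e → saturate M e ≡ true
  saturate-exposed {M} {e} exposed =
    trans (cong (M e ∨_) (dec-true (Exposed? M e) exposed)) (∨-zeroʳ (M e))

  saturate-cases : ∀ {M e} → saturate M e ≡ true → M e ≡ true ⊎ Exposed M e
  saturate-cases {M} {e} h with M e
  ... | true  = inj₁ refl
  ... | false = inj₂ (does⇒ (Exposed? M e) h)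

  saturate-uncovered : ∀ {M z} → ¬ Covered G (saturate M) z → ¬ Covered G M z
  saturate-uncovered uncovered (g , g∈M , z∈g) = uncovered (g , saturate-⊇ g∈M , z∈g)

  saturate-saturated : ∀ M → Saturated (saturate M)
  saturate-saturated M e (a-exposed , b-exposed) =
    saturate-exposed (saturate-uncovered a-exposed , saturate-uncovered b-exposed)

  -- Saturating preserves perfect internal matchings: two added edges meeting at z would both
  -- join z to its unique neighbour.
  saturate-PIM : ∀ {M} → IsPIM (Everything G) M →
                 IsPIM (Everything G) (saturate M)
  saturate-PIM {M} ((_ , matching) , degree) =
    ((λ _ _ → tt , tt) , disjoint) , λ v _ uncovered → degree v tt (saturate-uncovered uncovered)
    where
    disjoint : ∀ g h → saturate M g ≡ true → saturate M h ≡ true → g ≢ h → ¬ Meets g h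
    disjoint g h g∈ h∈ g≢h (z , z∈g , z∈h) with saturate-cases {M} {g} g∈ | saturate-cases {M} {h} h∈
    ... | inj₁ g∈M | inj₁ h∈M = matching g h g∈M h∈M g≢h (z , z∈g , z∈h)
    ... | inj₁ g∈M | inj₂ h-exp = exposed-end {e = h} h-exp z∈h (g , g∈M , z∈g)
    ... | inj₂ g-exp | inj₁ h∈M = exposed-end {e = g} g-exp z∈g (h , h∈M , z∈h)
    ... | inj₂ g-exp | inj₂ _ with degree z tt (exposed-end {e = g} g-exp z∈g)
    ...   | _ , _ , _ , unique with partner {e = g} z∈g
    ...     | y , y∈g , z~y =
      g≢h (edge-unique g h (~⇒≢ z~y) z∈g y∈g z∈h (leaf-edge {y = h} unique′ z∈h))
      where
      unique′ : ∀ w′ → z ~ w′ → w′ ≡ y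
      unique′ w′ z~w′ = trans (unique w′ tt z~w′) (sym (unique y tt z~y))

  restrict : ∀ {C : V → Set} → (∀ v → Dec (C v)) → (E → Bool) → E → Bool
  restrict C? M g = M g ∧ does (C? (Edge.a g))

  restrict-keeps : ∀ {C : V → Set} (C? : ∀ v → Dec (C v)) {M : E → Bool} {g : E} →
                   EdgeIn G C g → M g ≡ true → restrict C? M g ≡ true
  restrict-keeps C? {g = g} (Ca , _) g∈M rewrite g∈M = dec-true (C? (Edge.a g)) Ca

  restrict-⊆ : ∀ {C : V → Set} (C? : ∀ v → Dec (C v)) {M : E → Bool} {g : E} →
               restrict C? M g ≡ true → M g ≡ true × C (Edge.a g)
  restrict-⊆ C? {M} {g} h with M g
  ... | true = refl , does⇒ (C? (Edge.a g)) h

  restrict-PIM : ∀ {C : V → Set} {M : E → Bool} (C? : ∀ v → Dec (C v)) → Closed C → IsPIM (Everything G) M →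
                 IsPerfectInternalMatching G C (restrict C? M)
  restrict-PIM {C} {M} C? closed ((_ , matching) , degree) = (inside , disjoint) , degree′
    where
    inside : ∀ g → restrict C? M g ≡ true → EdgeIn G C g
    inside g h = closed-edge {g = g} closed (proj₂ (restrict-⊆ C? {M} {g} h)) (inj₁ refl)
    disjoint : ∀ g h → restrict C? M g ≡ true → restrict C? M h ≡ true → g ≢ h → ¬ Meets g h
    disjoint g h g∈ h∈ = matching g h (proj₁ (restrict-⊆ C? {M} {g} g∈)) (proj₁ (restrict-⊆ C? {M} {h} h∈))
    degree′ : ∀ v → C v → ¬ Covered G (restrict C? M) v → DegreeOne G C v
    degree′ v Cv uncovered = degree-one-within closed Cv (degree v tt λ (g , g∈M , v∈g) →
      uncovered (g , restrict-keeps C? {M} {g} (closed-edge {g = g} closed Cv v∈g) g∈M , v∈g))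

  Intersecting : (E → Set) → Set
  Intersecting F = ∀ g k → F g → F k → Meets g k

  stable-intersecting : ∀ {S} → IsStable H S → Intersecting (λ y → S y ≡ true)
  stable-intersecting S-stable g k Sg Sk with g ≟ₑ k
  ... | yes refl = meets-refl g
  ... | no g≢k = stable-meets S-stable Sg Sk g≢k

  -- If G has an edge, every maximal stable set of H is nonempty: otherwise that edge alone
  -- would be a larger stable set.
  maximal-stable-inhabited : ∀ {S} → IsMaximalStable H S → E → ∃ λ y → S y ≡ true
  maximal-stable-inhabited {S} (_ , S-max) x₀ with any-edge? (λ y → S y ≟ᵇ true)
  ... | yes inhabited = inhabited
  ... | no none =
    ⊥-elim (none (x₀ , S-max (only x₀) (only-stable x₀) (λ y Sy → ⊥-elim (none (y , Sy))) x₀ (only-self x₀)))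

  exposed-edgeOn : ∀ {M v w} (p : v ~ w) → ¬ Covered G M v → ¬ Covered G M w → Exposed M (edgeOn v w p)
  exposed-edgeOn {M} {v} {w} p v-exposed w-exposed = on-edge (inj₁ refl) , on-edge (inj₂ refl)
    where
    on-edge : ∀ {z} → z ∈ₑ edgeOn v w p → ¬ Covered G M z
    on-edge z∈ with edgeOn-only p z∈
    ... | inj₁ refl = v-exposed
    ... | inj₂ refl = w-exposed

  -- If all edges of a maximal stable set S of H pass through v, then S contains an edge of every
  -- saturated PIM M: either v is covered by M, or v is a leaf whose neighbour w is covered, or
  -- vw has both ends exposed and so lies in M.  In each case the edge is in S by maximality.
  star-meets-PIM : ∀ {S M v} → IsMaximalStable H S → (∀ y → S y ≡ true → v ∈ₑ y) →
                   IsPIM (Everything G) M → Saturated M →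
                   ∃ λ x → S x ≡ true × M x ≡ true
  star-meets-PIM {S} {M} {v} S-max S⊆v (_ , degree) saturated with Covered? M v
  ... | yes (g , g∈M , v∈g) = g , star-⊆-maximal S-max S⊆v g v∈g , g∈M
  ... | no v-exposed with degree v tt v-exposed
  ...   | w , _ , v~w , unique with Covered? M w
  ...     | yes (g , g∈M , w∈g) =
    g , star-⊆-maximal S-max (λ y Sy → leaf-edge {y = y} (λ w′ → unique w′ tt) (S⊆v y Sy)) g w∈g , g∈M
  ...     | no w-exposed =
    edgeOn v w v~w , star-⊆-maximal S-max S⊆v _ (proj₁ (edgeOn-ends v w v~w)) ,
    saturated _ (exposed-edgeOn v~w v-exposed w-exposed)

  TwoExtendable : Set
  TwoExtendable = ∀ e f → Is2Matching G (Everything G) e f → ExtendsToPIM G (Everything G) e f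

  -- (2) restricts to components: a 2-matching of a component extends to a PIM of G, whose
  -- restriction to the component is a PIM of the component.
  extendable-in-component : TwoExtendable → ∀ x e f → Is2Matching G (Reach G x) e f → ExtendsToPIM G (Reach G x) e f
  extendable-in-component extendable x e f (e∈ , f∈ , e≢f , e∦f)
    with extendable e f ((tt , tt) , (tt , tt) , e≢f , e∦f)
  ... | M , e∈M , f∈M , pim =
    restrict (Reach? x) M , restrict-keeps (Reach? x) {M} {e} e∈ e∈M , restrict-keeps (Reach? x) {M} {f} f∈ f∈M ,
    restrict-PIM (Reach? x) Reach-closed pim

  Is2Matching? : ∀ {C : V → Set} → (∀ v → Dec (C v)) → ∀ e f → Dec (Is2Matching G C e f)
  Is2Matching? C? e f = EdgeIn? C? e ×-dec EdgeIn? C? f ×-dec ¬? (e ≟ₑ f) ×-dec ¬? (Meets? e f)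

  in-edge : ∀ {C : V → Set} {z g} → EdgeIn G C g → z ∈ₑ g → C z
  in-edge (Ca , _) (inj₁ refl) = Ca
  in-edge (_ , Cb) (inj₂ refl) = Cb

  star-intersecting : ∀ {C : V → Set} → IsStar G C → Intersecting (EdgeIn G C)
  star-intersecting {C} (c , _ , _ , _ , through) g k g∈ k∈ = c , centre-on g g∈ , centre-on k k∈
    where
    centre-on : ∀ t → EdgeIn G C t → c ∈ₑ t
    centre-on t (Ca , Cb) with through (Edge.a t) (Edge.b t) Ca Cb (Edge.isAdj t)
    ... | inj₁ a≡c = inj₁ (sym a≡c)
    ... | inj₂ b≡c = inj₂ (sym b≡c)

  centred-adjacent : ∀ {x c y} → (∀ {u v} → Reach G x u → u ~ v → u ≡ c ⊎ v ≡ c) →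
                     Reach G x c → Reach G c y → y ≡ c ⊎ c ~ y
  centred-adjacent through xc here = inj₁ refl
  centred-adjacent through xc (step cv v~w) with centred-adjacent through xc cv
  ... | inj₁ refl = inj₂ v~w
  ... | inj₂ c~v with through (Reach-trans xc cv) v~w
  ...   | inj₁ refl = inj₂ v~w
  ...   | inj₂ refl = inj₁ refl

  centred-component-star : ∀ {x c w} → (∀ {u v} → Reach G x u → u ~ v → u ≡ c ⊎ v ≡ c) →
                           Reach G x c → c ~ w → IsStar G (Reach G x)
  centred-component-star {x} {c} {w} through xc c~w =
    c , xc , (w , step xc c~w , ~⇒≢ c~w ∘ sym) , adjacent , λ u v xu _ u~v → through xu u~v
    where
    adjacent : ∀ y → Reach G x y → y ≢ c → c ~ y
    adjacent y xy y≢c with centred-adjacent through xc (Reach-trans (Reach-sym xc) xy)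
    ... | inj₁ y≡c = ⊥-elim (y≢c y≡c)
    ... | inj₂ c~y = c~y

  -- Gluing one matching per component: each edge takes its membership from the matching chosen
  -- for the representative of its component.
  glue : (V → E → Bool) → E → Bool
  glue K g = K (rep (Edge.a g)) g

  rep-along : ∀ {z g} → z ∈ₑ g → rep (Edge.a g) ≡ rep z
  rep-along {g = g} z∈g = rep-cong (Reach-along {g = g} z∈g)

  own-component : ∀ g → EdgeIn G (Reach G (rep (Edge.a g))) g
  own-component g = closed-edge {g = g} Reach-closed (Reach-sym (rep-reach (Edge.a g))) (inj₁ refl)

  glue-PIM : ∀ K → (∀ ρ → IsPIM (Reach G ρ) (K ρ)) →
             IsPIM (Everything G) (glue K)
  glue-PIM K pims = ((λ _ _ → tt , tt) , disjoint) , degree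
    where
    at : ∀ {z g} → z ∈ₑ g → glue K g ≡ true → K (rep z) g ≡ true
    at {g = g} z∈g g∈ = subst (λ ρ → K ρ g ≡ true) (rep-along {g = g} z∈g) g∈
    disjoint : ∀ g h → glue K g ≡ true → glue K h ≡ true → g ≢ h → ¬ Meets g h
    disjoint g h g∈ h∈ g≢h (z , z∈g , z∈h) =
      proj₂ (proj₁ (pims (rep z))) g h (at {g = g} z∈g g∈) (at {g = h} z∈h h∈) g≢h (z , z∈g , z∈h)
    degree : ∀ v → Everything G v → ¬ Covered G (glue K) v → DegreeOne G (Everything G) v
    degree v _ uncovered = degree-one-without Reach-closed v∈ (proj₂ (pims (rep v)) v v∈ λ (g , g∈ , v∈g) →
      uncovered (g , subst (λ ρ → K ρ g ≡ true) (sym (rep-along {g = g} v∈g)) g∈ , v∈g))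
      where
      v∈ : Reach G (rep v) v
      v∈ = Reach-sym (rep-reach v)

  module _ (triangle-free : TriangleFree G) where

    no-edge-through-neighbours : ∀ {v w₁ w₂ g} → v ~ w₁ → v ~ w₂ → w₁ ≢ w₂ → w₁ ∈ₑ g → w₂ ∈ₑ g → ⊥
    no-edge-through-neighbours {v} {w₁} {w₂} {g} v~w₁ v~w₂ w₁≢w₂ w₁∈g w₂∈g =
      triangle-free v w₁ w₂ v~w₁ (ends-adj {e = g} w₁∈g w₂∈g w₁≢w₂) v~w₂

    -- The star of a branching vertex is a maximal stable set of H: an edge avoiding v that is
    -- stable with the whole star would join the two neighbours of v.
    star-maximal : ∀ {v} → Branching v → IsMaximalStable H (star v)
    star-maximal {v} (w₁ , w₂ , v~w₁ , v~w₂ , w₁≢w₂) = star-stable v , λ T T-stable star⊆T x Tx →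
      dec-true (v ∈ₑ? x) (decidable-stable (v ∈ₑ? x) λ v∉x →
        no-edge-through-neighbours {g = x} v~w₁ v~w₂ w₁≢w₂
          (stable-avoiding T-stable Tx v∉x v~w₁ (star⊆T _ (in-star v~w₁)))
          (stable-avoiding T-stable Tx v∉x v~w₂ (star⊆T _ (in-star v~w₂))))
      where
      in-star : ∀ {w} (p : v ~ w) → star v (edgeOn v w p) ≡ true
      in-star {w} p = dec-true (v ∈ₑ? edgeOn v w p) (proj₁ (edgeOn-ends v w p))

    -- Take y = pq in F; if some t ∈ F
    -- avoids p, then t passes through q and its other end d, and every edge of F avoiding q
    -- would contain both p and d, closing the triangle p q d.
    common-vertex : ∀ {F} → (∀ e → Dec (F e)) → Intersecting F → ∃ F → ∃ λ c → ∀ t → F t → c ∈ₑ t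
    common-vertex {F} F? meets (y , Fy) = from-avoider (any-edge? λ t → F? t ×-dec ¬? (p ∈ₑ? t))
      where
      p q : V
      p = Edge.a y
      q = Edge.b y
      p≢q : p ≢ q
      p≢q = ~⇒≢ (Edge.isAdj y)
      from-avoider : Dec (∃ λ t → F t × ¬ p ∈ₑ t) → ∃ λ c → ∀ t → F t → c ∈ₑ t
      from-avoider (no none) = p , λ t Ft → decidable-stable (p ∈ₑ? t) λ p∉t → none (t , Ft , p∉t)
      from-avoider (yes (w , Fw , p∉w)) = q , λ t Ft → decidable-stable (q ∈ₑ? t) (triangle t Ft)
        where
        q∈w : q ∈ₑ w
        q∈w = meets-at-other {g = w} {k = y} (inj₁ refl) (inj₂ refl) p≢q (meets w y Fw Fy) p∉w
        d : V
        d = proj₁ (partner {e = w} q∈w)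
        d∈w : d ∈ₑ w
        d∈w = proj₁ (proj₂ (partner {e = w} q∈w))
        q~d : q ~ d
        q~d = proj₂ (proj₂ (partner {e = w} q∈w))
        triangle : ∀ t → F t → ¬ q ∈ₑ t → ⊥
        triangle t Ft q∉t = no-edge-through-neighbours {g = t} (~-sym (Edge.isAdj y)) q~d
          (λ p≡d → p∉w (subst (_∈ₑ w) (sym p≡d) d∈w))
          (meets-at-other {g = t} {k = y} (inj₂ refl) (inj₁ refl) (p≢q ∘ sym) (meets t y Ft Fy) q∉t)
          (meets-at-other {g = t} {k = w} q∈w d∈w (~⇒≢ q~d) (meets t w Ft Fw) q∉t)

    -- If an edge h of G[C] meets every edge of G[C], then {h} is a PIM of G[C]: every vertex
    -- off h has all its neighbours on h, hence only one of them.
    single-edge-PIM : ∀ {C : V → Set} {h : E} → NoIsolatedVertices G → Closed C → EdgeIn G C h →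
                      (∀ g → EdgeIn G C g → Meets h g) → IsPerfectInternalMatching G C (only h)
    single-edge-PIM {C} {h} no-isolated closed h∈C meets-h = (inside , disjoint) , degree
      where
      inside : ∀ g → only h g ≡ true → EdgeIn G C g
      inside g g∈ = subst (EdgeIn G C) (sym (only-unique g∈)) h∈C
      disjoint : ∀ g k → only h g ≡ true → only h k ≡ true → g ≢ k → ¬ Meets g k
      disjoint g k g∈ k∈ g≢k _ = g≢k (trans (only-unique g∈) (sym (only-unique k∈)))
      degree : ∀ v → C v → ¬ Covered G (only h) v → DegreeOne G C v
      degree v Cv uncovered with no-isolated v
      ... | w , v~w = w , closed Cv v~w , v~w , λ w′ _ v~w′ →
        decidable-stable (w′ ≟ w) λ w′≢w →
          no-edge-through-neighbours {g = h} v~w′ v~w w′≢w (on-h v~w′) (on-h v~w)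
        where
        v∉h : ¬ v ∈ₑ h
        v∉h v∈h = uncovered (h , only-self h , v∈h)
        on-h : ∀ {u} (p : v ~ u) → u ∈ₑ h
        on-h {u} p =
          let (v∈ , u∈) = edgeOn-ends v u p
          in meets-at-other {g = h} {k = edgeOn v u p} v∈ u∈ (~⇒≢ p)
               (meets-h (edgeOn v u p) (closed-edge {g = edgeOn v u p} closed Cv v∈)) v∉h

    -- Every maximal stable set of H contains an edge of every nonempty saturated PIM, since its
    -- edges pairwise meet and so pass through a common vertex.
    maximal-stable-meets-PIM : ∀ {S M} → IsMaximalStable H S → IsPIM (Everything G) M →
                               Saturated M → (∃ λ x → M x ≡ true) → ∃ λ x → S x ≡ true × M x ≡ true
    maximal-stable-meets-PIM {S} S-max pim saturated (x₀ , _)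
      with common-vertex (λ y → S y ≟ᵇ true) (stable-intersecting (proj₁ S-max)) (maximal-stable-inhabited S-max x₀)
    ... | v , S⊆v = star-meets-PIM S-max S⊆v pim saturated

    intersecting-component-star : NoIsolatedVertices G → ∀ x → Intersecting (EdgeIn G (Reach G x)) →
                                  IsStar G (Reach G x)
    intersecting-component-star no-isolated x meets =
      centred-at (common-vertex (EdgeIn? (Reach? x)) meets (g₀ , g₀-in))
      where
      w₀ : V
      w₀ = proj₁ (no-isolated x)
      x~w₀ : x ~ w₀
      x~w₀ = proj₂ (no-isolated x)
      g₀ : E
      g₀ = edgeOn x w₀ x~w₀
      g₀-in : EdgeIn G (Reach G x) g₀
      g₀-in = closed-edge {g = g₀} Reach-closed here (proj₁ (edgeOn-ends x w₀ x~w₀))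
      centred-at : (∃ λ c → ∀ t → EdgeIn G (Reach G x) t → c ∈ₑ t) → IsStar G (Reach G x)
      centred-at (c , on-all) =
        centred-component-star through (in-edge {g = g₀} g₀-in c∈g₀) (proj₂ (proj₂ (partner {e = g₀} c∈g₀)))
        where
        c∈g₀ : c ∈ₑ g₀
        c∈g₀ = on-all g₀ g₀-in
        through : ∀ {u v} → Reach G x u → u ~ v → u ≡ c ⊎ v ≡ c
        through {u} {v} xu u~v with edgeOn-only u~v (on-all (edgeOn u v u~v)
                                      (closed-edge {g = edgeOn u v u~v} Reach-closed xu (proj₁ (edgeOn-ends u v u~v))))
        ... | inj₁ c≡u = inj₁ (sym c≡u)
        ... | inj₂ c≡v = inj₂ (sym c≡v)

    module _ (no-isolated : NoIsolatedVertices G) where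

      -- A 2-matching e, f is adjacent in H, so e and f share a label u.  The star of a
      -- branching vertex is a maximal stable set of H, so it contains an edge labelled u.  Edges
      -- sharing a label are disjoint, so e, f and one such edge at each branching vertex form a
      -- matching; the vertices it misses are not branching, i.e. they are leaves.
      partition⇒extendable : IsGeneralPartitionGraph H → TwoExtendable
      partition⇒extendable (U , label , _ , adjacency , partition) e f (_ , _ , e≢f , e∦f) =
        M , dec-true (InM? e) (inj₁ refl) , dec-true (InM? f) (inj₂ (inj₁ refl)) ,
        ((λ _ _ → tt , tt) , matching) , degree
        where
        common : ∃ λ u → label e u × label f u
        common = proj₁ (adjacency e f e≢f) (disjoint⇒H e∦f)
        u : U
        u = proj₁ common
        labelled-at : ∀ v → Branching v → ∃ λ g → v ∈ₑ g × label g u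
        labelled-at v branching with proj₁ (partition (star v) (star-maximal branching)) u
        ... | g , g∈star , g-labelled = g , does⇒ (v ∈ₑ? g) g∈star , g-labelled
        chosen : ∀ v → Dec (Branching v) → Maybe E
        chosen v (yes branching) = just (proj₁ (labelled-at v branching))
        chosen v (no _)          = nothing
        chosen-labelled : ∀ v branching? g → chosen v branching? ≡ just g → label g u
        chosen-labelled v (yes branching) _ refl = proj₂ (proj₂ (labelled-at v branching))
        chosen-labelled v (no _) _ ()
        chosen-at : ∀ v → Branching v → ∃ λ g → v ∈ₑ g × chosen v (Branching? v) ≡ just g
        chosen-at v branching with Branching? v
        ... | yes branching′ = proj₁ (labelled-at v branching′) , proj₁ (proj₂ (labelled-at v branching′)) , refl
        ... | no ¬branching  = ⊥-elim (¬branching branching)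
        InM : E → Set
        InM g = g ≡ e ⊎ g ≡ f ⊎ ∃ λ v → chosen v (Branching? v) ≡ just g
        InM? : ∀ g → Dec (InM g)
        InM? g = (g ≟ₑ e) ⊎-dec (g ≟ₑ f) ⊎-dec any? λ v → ≡-dec _≟ₑ_ (chosen v (Branching? v)) (just g)
        M : E → Bool
        M g = does (InM? g)
        labelled : ∀ g → M g ≡ true → label g u
        labelled g g∈ with does⇒ (InM? g) g∈
        ... | inj₁ refl             = proj₁ (proj₂ common)
        ... | inj₂ (inj₁ refl)      = proj₂ (proj₂ common)
        ... | inj₂ (inj₂ (v , g≡))  = chosen-labelled v (Branching? v) g g≡
        matching : ∀ g h → M g ≡ true → M h ≡ true → g ≢ h → ¬ Meets g h
        matching g h g∈ h∈ g≢h = H⇒disjoint (proj₂ (adjacency g h g≢h) (u , labelled g g∈ , labelled h h∈))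
        degree : ∀ v → Everything G v → ¬ Covered G M v → DegreeOne G (Everything G) v
        degree v _ uncovered = unbranched⇒degree-one no-isolated λ branching →
          let (g , v∈g , g≡) = chosen-at v branching
          in uncovered (g , dec-true (InM? g) (inj₂ (inj₂ (v , g≡))) , v∈g)

      Label : Set
      Label = Σ (E → Bool) λ M → IsPIM (Everything G) M × Saturated M × ∃ (λ x → M x ≡ true)

      Carries : E → Label → Set
      Carries x L = proj₁ L x ≡ true

      label-through : ∀ {M x} → IsPIM (Everything G) M → M x ≡ true → Σ Label (Carries x)
      label-through {M} {x} pim x∈M =
        (saturate M , saturate-PIM pim , saturate-saturated M , x , saturate-⊇ x∈M) , saturate-⊇ x∈M

      -- Under (2) every edge x lies in a PIM: one extending a 2-matching through x, or {x} itself
      -- if x meets every edge.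
      PIM-through : TwoExtendable → ∀ x → Σ (E → Bool) λ M → M x ≡ true × IsPIM (Everything G) M
      PIM-through extendable x with any-edge? (λ y → ¬? (Meets? x y))
      ... | yes (y , x∦y) =
        let (M , x∈M , _ , pim) = extendable x y ((tt , tt) , (tt , tt) , disjoint⇒≢ x∦y , x∦y) in M , x∈M , pim
      ... | no none = only x , only-self x ,
        single-edge-PIM no-isolated (λ _ _ → tt) (tt , tt) λ g _ →
          decidable-stable (Meets? x g) λ x∦g → none (g , x∦g)

      -- Label every edge by the nonempty saturated PIMs containing it.  Disjoint
      -- edges share such a label by (2); edges sharing a label are disjoint; and a maximal stable
      -- set of H contains exactly one edge of each label.
      extendable⇒partition : TwoExtendable → IsGeneralPartitionGraph H
      extendable⇒partition extendable = Label , Carries , labelled , adjacency , partition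
        where
        labelled : ∀ x → ∃ (Carries x)
        labelled x = let (M , x∈M , pim) = PIM-through extendable x in label-through pim x∈M
        shared⇒H : ∀ {x y} → x ≢ y → ∀ L → Carries x L → Carries y L → H x y
        shared⇒H {x} {y} x≢y (_ , ((_ , matching) , _) , _) x∈ y∈ = disjoint⇒H (matching x y x∈ y∈ x≢y)
        adjacency : ∀ x y → x ≢ y →
                    (H x y → ∃ λ L → Carries x L × Carries y L) × ((∃ λ L → Carries x L × Carries y L) → H x y)
        adjacency x y x≢y =
          (λ Hxy → let (M , x∈M , y∈M , pim) = extendable x y ((tt , tt) , (tt , tt) , x≢y , H⇒disjoint Hxy)
                   in proj₁ (label-through pim x∈M) , saturate-⊇ x∈M , saturate-⊇ y∈M) ,
          λ (L , x∈ , y∈) → shared⇒H x≢y L x∈ y∈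
        partition : ∀ S → IsMaximalStable H S →
                    (∀ L → ∃ λ x → S x ≡ true × Carries x L) ×
                    (∀ x y → S x ≡ true → S y ≡ true → x ≢ y → ∀ L → Carries x L → Carries y L → ⊥)
        partition S S-max =
          (λ (M , pim , saturated , inhabited) → maximal-stable-meets-PIM S-max pim saturated inhabited) ,
          λ x y Sx Sy x≢y L x∈ y∈ → proj₁ S-max x y Sx Sy (shared⇒H x≢y L x∈ y∈)

      StarOrExtendable : V → Set
      StarOrExtendable x = IsStar G (Reach G x) ⊎ TwoInternallyExtendable G (Reach G x)

      -- (2) ⇒ (3).  A component with a 2-matching inherits 2-extendability; one without a
      -- 2-matching has pairwise meeting edges and is therefore a star.
      extendable⇒components : TwoExtendable → ∀ x → StarOrExtendable x
      extendable⇒components extendable x with any-edge? (λ e → any-edge? λ f → Is2Matching? (Reach? x) e f)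
      ... | yes (e , f , two-matching) = inj₂ ((e , f , two-matching) , extendable-in-component extendable x)
      ... | no none = inj₁ (intersecting-component-star no-isolated x λ g k g∈ k∈ →
        decidable-stable (Meets? g k) λ g∦k → none (g , k , g∈ , k∈ , disjoint⇒≢ g∦k , g∦k))

      -- In a component satisfying (3), every edge h lies in a PIM of the component: if h meets
      -- every edge, {h} will do; otherwise the component is not a star and some 2-matching
      -- through h extends.
      component-PIM-through : ∀ {x h} → StarOrExtendable x → EdgeIn G (Reach G x) h →
                              Σ (E → Bool) λ M → M h ≡ true × IsPIM (Reach G x) M
      component-PIM-through {x} {h} condition h∈ with any-edge? (λ g → EdgeIn? (Reach? x) g ×-dec ¬? (Meets? h g))
      ... | no none = only h , only-self h ,
        single-edge-PIM no-isolated Reach-closed h∈ λ g g∈ →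
          decidable-stable (Meets? h g) λ h∦g → none (g , g∈ , h∦g)
      ... | yes (g , g∈ , h∦g) with condition
      ...   | inj₁ star = ⊥-elim (h∦g (star-intersecting star h g h∈ g∈))
      ...   | inj₂ (_ , extendable) =
        let (M , h∈M , _ , pim) = extendable h g (h∈ , g∈ , disjoint⇒≢ h∦g , h∦g) in M , h∈M , pim

      ComponentPIM : E → E → V → Set
      ComponentPIM e f ρ = Σ (E → Bool) λ M → IsPIM (Reach G ρ) M ×
        (EdgeIn G (Reach G ρ) e → M e ≡ true) × (EdgeIn G (Reach G ρ) f → M f ≡ true)

      component-PIM : ∀ {e f} → ¬ Meets e f → ∀ ρ → StarOrExtendable ρ → ComponentPIM e f ρ
      component-PIM {e} {f} e∦f ρ condition = by-cases (EdgeIn? (Reach? ρ) e) (EdgeIn? (Reach? ρ) f)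
        where
        both : StarOrExtendable ρ → EdgeIn G (Reach G ρ) e → EdgeIn G (Reach G ρ) f → ComponentPIM e f ρ
        both (inj₁ star) e∈ f∈ = ⊥-elim (e∦f (star-intersecting star e f e∈ f∈))
        both (inj₂ (_ , extendable)) e∈ f∈ =
          let (M , e∈M , f∈M , pim) = extendable e f (e∈ , f∈ , disjoint⇒≢ e∦f , e∦f)
          in M , pim , (λ _ → e∈M) , (λ _ → f∈M)
        by-cases : Dec (EdgeIn G (Reach G ρ) e) → Dec (EdgeIn G (Reach G ρ) f) → ComponentPIM e f ρ
        by-cases (yes e∈) (yes f∈) = both condition e∈ f∈
        by-cases (yes e∈) (no f∉) =
          let (M , e∈M , pim) = component-PIM-through {h = e} condition e∈ in M , pim , (λ _ → e∈M) , ⊥-elim ∘ f∉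
        by-cases (no e∉) (yes f∈) =
          let (M , f∈M , pim) = component-PIM-through {h = f} condition f∈ in M , pim , ⊥-elim ∘ e∉ , (λ _ → f∈M)
        by-cases (no e∉) (no f∉) =
          let (w , ρ~w) = no-isolated ρ
              (M , _ , pim) = component-PIM-through {h = edgeOn ρ w ρ~w} condition
                (closed-edge {g = edgeOn ρ w ρ~w} Reach-closed here (proj₁ (edgeOn-ends ρ w ρ~w)))
          in M , pim , ⊥-elim ∘ e∉ , ⊥-elim ∘ f∉

      -- (3) ⇒ (2).  Glue, over all components, PIMs containing the edges of the given 2-matching.
      components⇒extendable : (∀ x → StarOrExtendable x) → TwoExtendable
      components⇒extendable condition e f (_ , _ , _ , e∦f) =
        glue K , proj₁ (proj₂ (proj₂ (local (rep (Edge.a e))))) (own-component e) ,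
        proj₂ (proj₂ (proj₂ (local (rep (Edge.a f))))) (own-component f) ,
        glue-PIM K (proj₁ ∘ proj₂ ∘ local)
        where
        local : ∀ ρ → ComponentPIM e f ρ
        local ρ = component-PIM e∦f ρ (condition ρ)
        K : V → E → Bool
        K ρ = proj₁ (local ρ)

lemma6 : (G : Graph) → TriangleFree G → NoIsolatedVertices G →
    (IsGeneralPartitionGraph (Complement (LineAdj G))
      ⇔ (∀ e f → Is2Matching G (Everything G) e f → ExtendsToPIM G (Everything G) e f))
    × ((∀ e f → Is2Matching G (Everything G) e f → ExtendsToPIM G (Everything G) e f)
      ⇔ (∀ x → IsStar G (Reach G x) ⊎ TwoInternallyExtendable G (Reach G x)))
lemma6 G triangle-free no-isolated =
  mk⇔ (partition⇒extendable G triangle-free no-isolated) (extendable⇒partition G triangle-free no-isolated) ,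
  mk⇔ (extendable⇒components G triangle-free no-isolated) (components⇒extendable G triangle-free no-isolated)
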